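{- Let $\mathbf L=(L,\vee,\wedge)$ be a distributive lattice and $a\in L$. Then $\mathbf L$ can be embedded (as a lattice) into $(P_{\{a\}}(\mathbf L),\sqcup,\sqcap)$ via the prescription $x\mapsto(x,a)$.
   Context: For a lattice $\mathbf L$ and $S\subseteq L$, $P_S(\mathbf L):=\{(x,y)\in L^2\mid x\wedge y\leq z\leq x\vee y\text{ for all }z\in S\}$, with $(x,y)\sqcup(z,v):=(x\vee z,y\wedge v)$ and $(x,y)\sqcap(z,v):=(x\wedge z,y\vee v)$. -}

module Defs where

open import Level using (Level; _⊔_)
open import Data.Product using (_×_; _,_; proj₁; proj₂)
open import Algebra.Lattice.Bundles using (DistributiveLattice; RawLattice)

module _ {c ℓ : Level} (L : DistributiveLattice c ℓ) where
  open DistributiveLattice L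

  _≤L_ : Carrier → Carrier → Set ℓ
  x ≤L y = (x ∧ y) ≈ x

  -- membership in P_S(L), with the subset S given as a predicate
  InP : {s : Level} → (S : Carrier → Set s) → Carrier × Carrier → Set (c ⊔ ℓ ⊔ s)
  InP S (x , y) = ∀ z → S z → ((x ∧ y) ≤L z) × (z ≤L (x ∨ y))

  Single : Carrier → Carrier → Set ℓ
  Single a z = z ≈ a

  _⊔P_ : Carrier × Carrier → Carrier × Carrier → Carrier × Carrier
  (x , y) ⊔P (z , v) = (x ∨ z , y ∧ v)

  _⊓P_ : Carrier × Carrier → Carrier × Carrier → Carrier × Carrier
  (x , y) ⊓P (z , v) = (x ∧ z , y ∨ v)

  -- the ambient raw lattice (L², ⊔, ⊓) with componentwise equality;
  -- P_S(L) is a subset of it, carrying the restricted operations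
  PairRaw : RawLattice c ℓ
  PairRaw = record
    { Carrier = Carrier × Carrier
    ; _≈_ = λ p q → (proj₁ p ≈ proj₁ q) × (proj₂ p ≈ proj₂ q)
    ; _∧_ = _⊓P_
    ; _∨_ = _⊔P_
    }

{-# OPTIONS --safe #-}
module Submission where

open import Defs
open import Level using (Level)
open import Data.Product using (_×_; _,_; proj₁)
open import Algebra.Lattice.Bundles using (DistributiveLattice)
open import Algebra.Lattice.Morphism.Structures using (module LatticeMorphisms)
import Algebra.Lattice.Properties.Lattice as LatticeProperties
import Relation.Binary.Reasoning.Setoid as SetoidReasoning

module _ {c ℓ : Level} (L : DistributiveLattice c ℓ) where
  open DistributiveLattice L
  open LatticeProperties lattice using (∧-idem; ∨-idem)
  open SetoidReasoning setoid
  open LatticeMorphisms rawLattice (PairRaw L) using (IsLatticeMonomorphism)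

  ≤L-respˡ-≈ : ∀ {x x′ y} → x ≈ x′ → _≤L_ L x y → _≤L_ L x′ y
  ≤L-respˡ-≈ {x} {x′} {y} x≈x′ x≤y = begin
    x′ ∧ y ≈⟨ ∧-congʳ (sym x≈x′) ⟩
    x ∧ y  ≈⟨ x≤y ⟩
    x      ≈⟨ x≈x′ ⟩
    x′     ∎

  ≤L-respʳ-≈ : ∀ {x y y′} → y ≈ y′ → _≤L_ L x y → _≤L_ L x y′
  ≤L-respʳ-≈ y≈y′ x≤y = trans (∧-congˡ (sym y≈y′)) x≤y

  x∧y≤Ly : ∀ x y → _≤L_ L (x ∧ y) y
  x∧y≤Ly x y = begin
    (x ∧ y) ∧ y ≈⟨ ∧-assoc x y y ⟩
    x ∧ (y ∧ y) ≈⟨ ∧-congˡ (∧-idem y) ⟩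
    x ∧ y       ∎

  y≤Lx∨y : ∀ x y → _≤L_ L y (x ∨ y)
  y≤Lx∨y x y = begin
    y ∧ (x ∨ y) ≈⟨ ∧-congˡ (∨-comm x y) ⟩
    y ∧ (y ∨ x) ≈⟨ ∧-absorbs-∨ y x ⟩
    y           ∎

  InP-Single : ∀ x a → InP L (Single L a) (x , a)
  InP-Single x a z z≈a =
    ≤L-respʳ-≈ (sym z≈a) (x∧y≤Ly x a) , ≤L-respˡ-≈ (sym z≈a) (y≤Lx∨y x a)

  fixSecond-isLatticeMonomorphism : ∀ a → IsLatticeMonomorphism (_, a)
  fixSecond-isLatticeMonomorphism a = record
    { isLatticeHomomorphism = record
      { isRelHomomorphism = record { cong = λ x≈y → x≈y , refl }
      ; ∧-homo = λ x y → refl , sym (∨-idem a)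
      ; ∨-homo = λ x y → refl , sym (∧-idem a)
      }
    ; injective = proj₁
    }

corollary7 : {c ℓ : Level} (L : DistributiveLattice c ℓ) (a : DistributiveLattice.Carrier L) →
    ((x : DistributiveLattice.Carrier L) → InP L (Single L a) (x , a))
    × LatticeMorphisms.IsLatticeMonomorphism (DistributiveLattice.rawLattice L) (PairRaw L) (λ x → (x , a))
corollary7 L a = (λ x → InP-Single L x a) , fixSecond-isLatticeMonomorphism L a
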